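{- Let $w$ be a word and let $v$ be a (nonempty) factor of $w$. Let $\mathit{Occ}(v,w)$ be the set of starting positions of occurrences of $v$ in $w$, and for $i\in\mathit{Occ}(v,w)$ let $\delta(i,v)=\min\{y\in\mathit{Occ}(v,w): y>i\}-i$ (with $\delta(i,v)=\infty$ if $i=\max\mathit{Occ}(v,w)$). Then $vv$ is a primitively rooted square occurring in $w$ if and only if there exists $i\in\mathit{Occ}(v,w)$ such that $\delta(i,v)=|v|$.
   Context: A word $u$ is primitive if $u=y^k$ for a word $y$ and integer $k$ implies $y=u$. A square $uu$ is primitively rooted if $u$ is primitive. -}

module Defs where

open import Data.Nat using (ℕ; zero; suc; _+_; _<_)
open import Data.List using (List; []; _∷_; _++_; length)
open import Data.Product using (Σ; ∃; _×_; _,_)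
open import Relation.Binary.PropositionalEquality using (_≡_)
open import Relation.Nullary using (¬_)

_^_ : {A : Set} → List A → ℕ → List A
y ^ zero  = []
y ^ suc k = y ++ (y ^ k)

Primitive : {A : Set} → List A → Set
Primitive {A} u = (y : List A) (k : ℕ) → u ≡ y ^ k → y ≡ u

Factor : {A : Set} → List A → List A → Set
Factor {A} u w = Σ (List A) λ p → Σ (List A) λ s → w ≡ p ++ u ++ s

Occ : {A : Set} → List A → List A → ℕ → Set
Occ {A} v w i = Σ (List A) λ p → Σ (List A) λ s → (length p ≡ i) × (w ≡ p ++ v ++ s)

-- δ(i,v) = d  (finite d): i + d is the least occurrence of v in w greater than i
Delta≡ : {A : Set} → List A → List A → ℕ → ℕ → Set
Delta≡ v w i d = Occ v w (i + d) × (i < i + d) × (∀ j → i < j → j < i + d → ¬ Occ v w j)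

PrimRootedSquareIn : {A : Set} → List A → List A → Set
PrimRootedSquareIn v w = Primitive v × Factor (v ++ v) w

-- Lyndon–Schützenberger: commuting words are powers of a common word. Hence a
-- primitive word v equals none of its nontrivial rotations, i.e. v occurs in
-- v v only at positions 0 and |v|; conversely a proper power v = y^k (k ≥ 2,
-- y ≠ []) also occurs in v v at position |y|. So occurrences of v at i and
-- i + |v| with none in between are exactly the primitively rooted squares v v.
module Submission where

open import Defs
open import Data.List using (List; []; _∷_; _++_; length)
open import Data.List.Properties
  using (length-++; length-++-≤ˡ; length-++-≤ʳ; ++-assoc; ++-identityʳ; ++-identityʳ-unique; ++-conicalˡ; ∷-injective)
open import Data.Nat using (ℕ; zero; suc; pred; _+_; _≤_; _<_; z≤n; s≤s)
open import Data.Nat.Induction using (<-wellFounded)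
open import Data.Nat.Properties
  using (≤-total; ≤-trans; <⇒≤; <-irrefl; +-comm; +-suc; +-identityʳ; +-monoʳ-<; +-cancelˡ-≡; +-cancelˡ-<; m<m+n; m≤m+n)
open import Data.Empty using (⊥-elim)
open import Data.Product using (Σ; ∃; _×_; _,_; proj₁)
open import Data.Sum using (_⊎_; inj₁; inj₂)
open import Function.Bundles using (_⇔_; mk⇔)
open import Induction.WellFounded using (Acc; acc)
open import Relation.Nullary using (¬_)
open import Relation.Binary.PropositionalEquality
  using (_≡_; _≢_; refl; sym; trans; cong; subst; module ≡-Reasoning)

module _ {A : Set} where

  ++-split : (p q a b : List A) → p ++ a ≡ q ++ b → length p ≤ length q →
             ∃ λ r → q ≡ p ++ r × a ≡ r ++ b
  ++-split []      q       a b eq _         = q , refl , eq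
  ++-split (x ∷ p) (y ∷ q) a b eq (s≤s p≤q) with ∷-injective eq
  ... | refl , eq′ with ++-split p q a b eq′ p≤q
  ...   | r , refl , a≡rb = r , refl , a≡rb

  ++-injective-≡-length : (p q a b : List A) → length p ≡ length q → p ++ a ≡ q ++ b →
                          p ≡ q × a ≡ b
  ++-injective-≡-length []      []      a b _   eq = refl , eq
  ++-injective-≡-length (x ∷ p) (y ∷ q) a b |p|≡|q| eq with ∷-injective eq
  ... | refl , eq′ with ++-injective-≡-length p q a b (cong pred |p|≡|q|) eq′
  ...   | refl , a≡b = refl , a≡b

  ^-+ : (y : List A) (m n : ℕ) → y ^ m ++ y ^ n ≡ y ^ (m + n)
  ^-+ y zero    n = refl
  ^-+ y (suc m) n = trans (++-assoc y (y ^ m) (y ^ n)) (cong (y ++_) (^-+ y m n))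

  []^ : (n : ℕ) → ([] {A = A}) ^ n ≡ []
  []^ zero    = refl
  []^ (suc n) = []^ n

  ^-square-rotate : (y : List A) (k : ℕ) → y ^ suc k ++ y ^ suc k ≡ y ++ y ^ suc k ++ y ^ k
  ^-square-rotate y k = begin
    (y ++ y ^ k) ++ y ^ suc k  ≡⟨ ++-assoc y (y ^ k) (y ^ suc k) ⟩
    y ++ y ^ k ++ y ^ suc k    ≡⟨ cong (y ++_) (^-+ y k (suc k)) ⟩
    y ++ y ^ (k + suc k)       ≡⟨ cong (λ n → y ++ y ^ n) (+-comm k (suc k)) ⟩
    y ++ y ^ (suc k + k)       ≡⟨ cong (y ++_) (sym (^-+ y (suc k) k)) ⟩
    y ++ y ^ suc k ++ y ^ k    ∎
    where open ≡-Reasoning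

  CommonRoot : List A → List A → Set
  CommonRoot x y = Σ (List A) λ z → Σ ℕ λ a → Σ ℕ λ b → x ≡ z ^ a × y ≡ z ^ b

  CommonRoot-sym : {x y : List A} → CommonRoot x y → CommonRoot y x
  CommonRoot-sym (z , a , b , x≡ , y≡) = z , b , a , y≡ , x≡

  CommonRoot-++ʳ : {x r : List A} → CommonRoot x r → CommonRoot x (x ++ r)
  CommonRoot-++ʳ {x} {r} (z , a , b , refl , refl) = z , a , a + b , refl , ^-+ z a b

  -- If |x| ≤ |y| then x y = y x forces y = x r = r x, and we recurse on (x, r).
  commute⇒CommonRoot-acc : (x y : List A) → Acc _<_ (length x + length y) →
                           x ++ y ≡ y ++ x → CommonRoot x y
  commute⇒CommonRoot-acc [] y _ _ = y , 0 , 1 , refl , sym (++-identityʳ y)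
  commute⇒CommonRoot-acc x [] _ _ = x , 1 , 0 , sym (++-identityʳ x) , refl
  commute⇒CommonRoot-acc x@(_ ∷ x′) y@(_ ∷ y′) (acc rec) xy≡yx
    with ≤-total (length x) (length y)
  ... | inj₁ x≤y with ++-split x y y x xy≡yx x≤y
  ...   | r , refl , xr≡rx = CommonRoot-++ʳ (commute⇒CommonRoot-acc x r (rec smaller) xr≡rx)
    where
      smaller : length x + length r < length x + length (x ++ r)
      smaller = +-monoʳ-< (length x) (s≤s (length-++-≤ʳ r {x′}))
  commute⇒CommonRoot-acc x@(_ ∷ x′) y@(_ ∷ y′) (acc rec) xy≡yx
      | inj₂ y≤x with ++-split y x x y (sym xy≡yx) y≤x
  ...   | r , refl , yr≡ry =
    CommonRoot-sym (CommonRoot-++ʳ (commute⇒CommonRoot-acc y r (rec smaller) yr≡ry))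
    where
      smaller : length y + length r < length (y ++ r) + length y
      smaller = subst (length y + length r <_) (+-comm (length y) (length (y ++ r)))
                      (+-monoʳ-< (length y) (s≤s (length-++-≤ʳ r {y′})))

  commute⇒CommonRoot : (x y : List A) → x ++ y ≡ y ++ x → CommonRoot x y
  commute⇒CommonRoot x y = commute⇒CommonRoot-acc x y (<-wellFounded _)

  primitive⇒rotation-trivial : (r x : List A) → Primitive (r ++ x) → r ++ x ≡ x ++ r →
                               r ≡ [] ⊎ x ≡ []
  primitive⇒rotation-trivial r x prim rx≡xr with commute⇒CommonRoot r x rx≡xr
  ... | z , zero  , _     , r≡[] , _    = inj₁ r≡[]
  ... | z , suc a , zero  , _    , x≡[] = inj₂ x≡[]
  ... | z , suc a , suc b , refl , refl = inj₁ (trans (cong (_^ suc a) z≡[]) ([]^ (suc a)))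
    where
      z≡z^[2+a+b] : z ≡ z ++ z ^ (a + suc b)
      z≡z^[2+a+b] = trans (prim z (suc a + suc b) (^-+ z (suc a) (suc b))) (^-+ z (suc a) (suc b))
      z≡[] : z ≡ []
      z≡[] = ++-conicalˡ z (z ^ (a + b))
               (trans (cong (z ^_) (sym (+-suc a b))) (++-identityʳ-unique z z≡z^[2+a+b]))

  primitive⇒no-inner-occurrence : {v r s t : List A} → Primitive v →
                                  v ++ v ++ s ≡ r ++ v ++ t → length r < length v → r ≡ []
  -- Writing v = r x, comparing the occurrences of v after r yields r x = x r.
  primitive⇒no-inner-occurrence {v} {r} {s} {t} prim vvs≡rvt r<v
    with ++-split r v (v ++ t) (v ++ s) (sym vvs≡rvt) (<⇒≤ r<v)
  ... | x , refl , rxt≡xrxs with primitive⇒rotation-trivial r x prim rx≡xr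
    where
      rx≡xr : r ++ x ≡ x ++ r
      rx≡xr = proj₁ (++-injective-≡-length (r ++ x) (x ++ r) t (x ++ s)
                (trans (length-++ r) (trans (+-comm (length r) (length x)) (sym (length-++ x))))
                (trans rxt≡xrxs (trans (cong (x ++_) (++-assoc r x s)) (sym (++-assoc x r (x ++ s))))))
  ... | inj₁ r≡[] = r≡[]
  ... | inj₂ refl = ⊥-elim (<-irrefl (cong length (sym (++-identityʳ r))) r<v)

  no-inner-occurrence⇒primitive : {v : List A} → v ≢ [] →
    (∀ y t → 0 < length y → length y < length v → v ++ v ≢ y ++ v ++ t) → Primitive v
  no-inner-occurrence⇒primitive v≢[] _ y zero v≡[] = ⊥-elim (v≢[] v≡[])
  no-inner-occurrence⇒primitive v≢[] _ y (suc zero) v≡y =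
    sym (trans v≡y (++-identityʳ y))
  no-inner-occurrence⇒primitive v≢[] _ [] (suc (suc k)) v≡[]^ =
    ⊥-elim (v≢[] (trans v≡[]^ ([]^ k)))
  no-inner-occurrence⇒primitive v≢[] inner y@(c ∷ y′) (suc (suc k)) refl =
    ⊥-elim (inner y (y ^ suc k) (s≤s z≤n) |y|<|v| (^-square-rotate y (suc k)))
    where
      |y|<|v| : length y < length (y ^ suc (suc k))
      |y|<|v| = s≤s (≤-trans (length-++-≤ˡ y) (length-++-≤ʳ (y ^ suc k) {y′}))

  Occ-at : {v w : List A} (p r t : List A) → w ≡ p ++ r ++ v ++ t → Occ v w (length p + length r)
  Occ-at {v} p r t w≡prvt = p ++ r , t , length-++ p , trans w≡prvt (sym (++-assoc p r (v ++ t)))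

  Occ-after : {v w p a : List A} {j : ℕ} → w ≡ p ++ a → Occ v w j → length p ≤ j →
              Σ (List A) λ r → Σ (List A) λ t → length p + length r ≡ j × a ≡ r ++ v ++ t
  Occ-after {v} {p = p} {a} w≡pa (q , t , |q|≡j , w≡qvt) p≤j
    with ++-split p q a (v ++ t) (trans (sym w≡pa) w≡qvt) (subst (length p ≤_) (sym |q|≡j) p≤j)
  ... | r , refl , a≡rvt = r , t , trans (sym (length-++ p)) |q|≡j , a≡rvt

  square⇒isolated : {v w p s : List A} → Primitive v → v ≢ [] → w ≡ p ++ (v ++ v) ++ s →
                    Occ v w (length p) × Delta≡ v w (length p) (length v)
  square⇒isolated {v} {w} {p} {s} prim v≢[] w≡pvvs =
    (p , v ++ s , refl , w≡pvvs′) , Occ-at p v s w≡pvvs′ , m<m+n (length p) (nonempty v v≢[]) , none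
    where
      nonempty : (u : List A) → u ≢ [] → 0 < length u
      nonempty []      u≢[] = ⊥-elim (u≢[] refl)
      nonempty (_ ∷ _) _    = s≤s z≤n
      w≡pvvs′ : w ≡ p ++ v ++ v ++ s
      w≡pvvs′ = trans w≡pvvs (cong (p ++_) (++-assoc v v s))
      none : ∀ j → length p < j → j < length p + length v → ¬ Occ v w j
      none j p<j j<p+v occ with Occ-after {p = p} w≡pvvs′ occ (<⇒≤ p<j)
      ... | r , t , refl , vvs≡rvt
        with primitive⇒no-inner-occurrence {r = r} prim vvs≡rvt
               (+-cancelˡ-< (length p) (length r) (length v) j<p+v)
      ... | refl = <-irrefl (sym (+-identityʳ (length p))) p<j

  isolated⇒square : {v w : List A} {i : ℕ} → v ≢ [] → Occ v w i → Delta≡ v w i (length v) →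
                    PrimRootedSquareIn v w
  isolated⇒square {v} {w} v≢[] (p , s , refl , w≡pvs) (next , _ , none)
    with Occ-after {p = p} w≡pvs next (m≤m+n (length p) (length v))
  ... | r , t , |p|+|r|≡|p|+|v| , vs≡rvt
    with ++-injective-≡-length v r s (v ++ t)
           (sym (+-cancelˡ-≡ (length p) (length r) (length v) |p|+|r|≡|p|+|v|)) vs≡rvt
  ... | refl , refl = no-inner-occurrence⇒primitive v≢[] inner , p , t , w≡pvvt
    where
      w≡pvvt : w ≡ p ++ (v ++ v) ++ t
      w≡pvvt = trans w≡pvs (cong (p ++_) (sym (++-assoc v v t)))
      inner : ∀ y u → 0 < length y → length y < length v → v ++ v ≢ y ++ v ++ u
      inner y u 0<|y| |y|<|v| vv≡yvu =
        none (length p + length y) (m<m+n (length p) 0<|y|) (+-monoʳ-< (length p) |y|<|v|)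
             (Occ-at p y (u ++ t) w≡pyvut)
        where
          w≡pyvut : w ≡ p ++ y ++ v ++ u ++ t
          w≡pyvut = begin
            w                         ≡⟨ w≡pvvt ⟩
            p ++ (v ++ v) ++ t        ≡⟨ cong (λ a → p ++ a ++ t) vv≡yvu ⟩
            p ++ (y ++ v ++ u) ++ t   ≡⟨ cong (p ++_) (++-assoc y (v ++ u) t) ⟩
            p ++ y ++ (v ++ u) ++ t   ≡⟨ cong (λ a → p ++ y ++ a) (++-assoc v u t) ⟩
            p ++ y ++ v ++ u ++ t     ∎
            where open ≡-Reasoning

mainTheorem2 : {A : Set} (w v : List A) → v ≢ [] → Factor v w →
    PrimRootedSquareIn v w ⇔ ∃ λ i → Occ v w i × Delta≡ v w i (length v)
mainTheorem2 w v v≢[] _ = mk⇔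
  (λ (prim , p , s , w≡pvvs) → length p , square⇒isolated {p = p} prim v≢[] w≡pvvs)
  (λ (i , occ , δ) → isolated⇒square v≢[] occ δ)
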